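{- Let $n \geq 4$ be an integer with $n \equiv 0 \pmod 4$ and $n \neq 8$. Then the honeycomb toroidal graph $\mathrm{HTG}(1,n,(n-2)/2)$ is not 2-spanning cyclable.
   Context: For integers $m\ge 1$, $\ell\ge 0$ and $n\ge 4$ with $n$ even and $m-\ell$ even, the honeycomb toroidal graph $\mathrm{HTG}(m,n,\ell)$ is the simple graph with vertex set $\{u_{i,j}: 0\le i\le m-1,\ 0\le j\le n-1\}$ (first subscript computed modulo $m$, second modulo $n$) whose edge set is the set of the following unordered pairs: $\{u_{i,j},u_{i,j+1}\}$ for all $i,j$ (vertical edges); $\{u_{i,j},u_{i+1,j}\}$ for all $0\le i\le m-2$ with $i+j$ odd (flat edges); and $\{u_{m-1,j},u_{0,j+\ell}\}$ for all $j$ having the same parity as $m$ (and $\ell$) (jump edges). (Repeated pairs give a single edge.) A 2-factor of a graph is a spanning subgraph in which every vertex has valency 2. A graph $X$ is 2-spanning cyclable if for every pair of distinct vertices $u,v$ of $X$ there is a 2-factor of $X$ consisting of exactly two cycles such that $u$ and $v$ lie in different cycles. -}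

module Defs where

open import Data.Nat using (ℕ; zero; suc; _+_; _*_; _∸_; _≤_)
open import Data.Fin using (Fin; toℕ)
open import Data.Product using (_×_; _,_; ∃; ∃-syntax)
open import Data.Sum using (_⊎_)
open import Data.List using (List; []; _∷_; _++_; [_]; length)
open import Data.List.Relation.Unary.Linked using (Linked)
open import Data.List.Relation.Unary.Unique.Propositional using (Unique)
open import Data.List.Membership.Propositional using (_∈_; _∉_)
open import Relation.Binary.PropositionalEquality using (_≡_; _≢_)
open import Data.Empty using (⊥)

-- congruence of natural numbers modulo n (no NonZero instance needed)
ModEq : ℕ → ℕ → ℕ → Set
ModEq n a b = ∃[ k ] (a ≡ b + k * n ⊎ b ≡ a + k * n)

Odd : ℕ → Set
Odd a = ModEq 2 a 1

SameParity : ℕ → ℕ → Set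
SameParity a b = ModEq 2 a b

Vertex : ℕ → ℕ → Set
Vertex m n = Fin m × Fin n

-- directed versions of the three edge kinds (from the first to the second vertex)
VerticalArc : (m n : ℕ) → Vertex m n → Vertex m n → Set
VerticalArc m n (i , j) (i' , j') = i ≡ i' × ModEq n (toℕ j') (toℕ j + 1)

FlatArc : (m n : ℕ) → Vertex m n → Vertex m n → Set
FlatArc m n (i , j) (i' , j') = toℕ i' ≡ suc (toℕ i) × j ≡ j' × Odd (toℕ i + toℕ j)

JumpArc : (m n ℓ : ℕ) → Vertex m n → Vertex m n → Set
JumpArc m n ℓ (i , j) (i' , j') =
  suc (toℕ i) ≡ m × toℕ i' ≡ 0 × SameParity (toℕ j) m × ModEq n (toℕ j') (toℕ j + ℓ)

Arc : (m n ℓ : ℕ) → Vertex m n → Vertex m n → Set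
Arc m n ℓ u v = VerticalArc m n u v ⊎ FlatArc m n u v ⊎ JumpArc m n ℓ u v

HTG : (m n ℓ : ℕ) → Vertex m n → Vertex m n → Set
HTG m n ℓ u v = u ≢ v × (Arc m n ℓ u v ⊎ Arc m n ℓ v u)

IsCycle : {V : Set} → (V → V → Set) → List V → Set
IsCycle Adj [] = ⊥
IsCycle Adj (x ∷ xs) = 3 ≤ length (x ∷ xs) × Unique (x ∷ xs) × Linked Adj (x ∷ xs ++ [ x ])

IsTwoCycleTwoFactor : {V : Set} → (V → V → Set) → List V → List V → Set
IsTwoCycleTwoFactor {V} Adj C₁ C₂ =
  IsCycle Adj C₁ × IsCycle Adj C₂ × (∀ (v : V) → v ∈ C₁ → v ∉ C₂) × (∀ (v : V) → v ∈ C₁ ⊎ v ∈ C₂)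

TwoSpanningCyclable : {V : Set} → (V → V → Set) → Set
TwoSpanningCyclable {V} Adj =
  ∀ (u v : V) → u ≢ v →
    ∃[ C₁ ] ∃[ C₂ ] (IsTwoCycleTwoFactor Adj C₁ C₂ × u ∈ C₁ × v ∈ C₂)

{-# OPTIONS --safe #-}
-- Write n = 4 (k + 3) and ℓ = (n - 2) / 2. Then HTG(1, n, ℓ) is the n-cycle with the extra edges
-- t — t + ℓ for odd t, and its vertices fall into k + 3 squares (4-cycles), consecutive squares being
-- joined by two edges and the last square joined back to the first one, among others by the edge 1 — 2.
-- Each vertex drops exactly one of its three edges in a 2-factor, so a square uses as many of its two
-- edges towards the previous square as of its two edges towards the next one. If 1 and 2 lie in
-- different cycles, the edge 1 — 2 is unused, so this number is 0 or 1 all around. If it is 0, every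
-- square is a cycle of the factor and the square after the one containing 2 meets neither cycle; if it
-- is 1, the factor runs through all squares from 2 to 1, which puts 1 and 2 on the same cycle.
-- For n = 4 the vertex 1 has only the neighbours 0 and 2, so the edge 1 — 2 is forced.
module Submission where

open import Defs
open import Data.Nat using (ℕ; zero; suc; _+_; _*_; _∸_; _≤_; _<_; s≤s; z≤n; _%_; _/_; NonZero)
open import Data.Nat.Properties
  using (≤-trans; ≤-<-trans; n≤1+n; <⇒≤; <-irrefl; <-≤-connex; m≢1+n+m; m≤m+n; m≤n+m; m∸n≤m; m<n⇒0<n∸m;
         +-comm; +-assoc; +-suc; +-identityʳ; +-cancelˡ-≡; +-cancelʳ-<; +-mono-<-≤; +-monoˡ-≤; *-monoʳ-≤;
         *-assoc; m∸n+n≡m; m+[n∸m]≡n)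
open import Data.Nat.DivMod
  using (m%n<n; m%n%n≡m%n; m<n⇒m%n≡m; [m+n]%n≡m%n; [m+kn]%n≡m%n; %-distribˡ-+; m∣n⇒o%n%m≡o%m; m*n/n≡m)
open import Data.Nat.Divisibility using (_∣_; divides; ∣-trans)
open import Data.Nat.Tactic.RingSolver using (solve-∀)
open import Data.Fin using (Fin; zero; toℕ; fromℕ<)
open import Data.Fin.Properties using (toℕ-fromℕ<; toℕ-injective; toℕ<n)
open import Function using (_∘_)
open import Data.Product using (_×_; _,_; ∃; ∃₂; proj₁; proj₂; uncurry)
open import Data.Sum using (_⊎_; inj₁; inj₂; swap; map₂)
open import Data.Empty using (⊥; ⊥-elim)
open import Data.List using (List; []; _∷_; _++_; [_]; length; _∷ʳ_; initLast; _∷ʳ′_)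
open import Data.List.Properties using (++-assoc; ∷-injective; ∷-injectiveˡ; ∷-injectiveʳ; ∷ʳ-injective; ∷ʳ-injectiveʳ; ∷ʳ-++)
open import Data.List.Relation.Unary.All using (All; []; _∷_)
import Data.List.Relation.Unary.All as All
open import Data.List.Relation.Unary.All.Properties using (All¬⇒¬Any)
open import Data.List.Relation.Unary.AllPairs using (_∷_)
open import Data.List.Relation.Unary.Any using (here; there)
open import Data.List.Relation.Unary.Linked using (Linked; _∷_)
open import Data.List.Relation.Unary.Unique.Propositional using (Unique)
open import Data.List.Membership.Propositional using (_∈_; _∉_)
open import Data.List.Membership.Propositional.Properties using (∈-++⁺ʳ; ∈-∃++)
open import Relation.Nullary using (¬_)
open import Relation.Binary.PropositionalEquality using (_≡_; _≢_; refl; sym; trans; cong; subst; ≢-sym; cong₂; subst₂; module ≡-Reasoning)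

module _ {V : Set} where

  Follows : List V → V → V → Set
  Follows C y z = (∃₂ λ as bs → C ≡ as ++ y ∷ z ∷ bs) ⊎ (∃ λ as → C ≡ z ∷ as ++ [ y ])

  unique-split : ∀ as as′ {v : V} {r r′} → Unique (as ++ v ∷ r) →
                 as ++ v ∷ r ≡ as′ ++ v ∷ r′ → as ≡ as′ × r ≡ r′
  unique-split []       []        _        eq = refl , ∷-injectiveʳ eq
  unique-split []       (a ∷ as′) (v∉ ∷ _) eq with refl , eq′ ← ∷-injective eq =
    ⊥-elim (All¬⇒¬Any v∉ (subst (_ ∈_) (sym eq′) (∈-++⁺ʳ as′ (here refl))))
  unique-split (a ∷ as) []        (v∉ ∷ _) eq with refl , _ ← ∷-injective eq =
    ⊥-elim (All¬⇒¬Any v∉ (∈-++⁺ʳ as (here refl)))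
  unique-split (a ∷ as) (a′ ∷ as′) (_ ∷ u) eq with refl , eq′ ← ∷-injective eq
    with refl , r≡r′ ← unique-split as as′ u eq′ = refl , r≡r′

  unique-position : ∀ {C : List V} as as′ {v r r′} → Unique C →
                    C ≡ as ++ v ∷ r → C ≡ as′ ++ v ∷ r′ → length as ≡ length as′
  unique-position as as′ u refl eq = cong length (proj₁ (unique-split as as′ u eq))

  length-∷ʳ : ∀ (as : List V) y → length (as ∷ʳ y) ≡ suc (length as)
  length-∷ʳ []       y = refl
  length-∷ʳ (_ ∷ as) y = cong suc (length-∷ʳ as y)

  ∷ʳ≢[] : ∀ (as : List V) {y} → as ∷ʳ y ≢ []
  ∷ʳ≢[] []      ()
  ∷ʳ≢[] (_ ∷ _) ()

  follows-functional : ∀ {C v y y′} → Unique C → Follows C v y → Follows C v y′ → y ≡ y′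
  follows-functional u (inj₁ (as , _ , refl)) (inj₁ (as′ , _ , eq)) =
    ∷-injectiveˡ (proj₂ (unique-split as as′ u eq))
  follows-functional u (inj₁ (as , _ , refl)) (inj₂ (cs , eq))
    with () ← proj₂ (unique-split as (_ ∷ cs) u eq)
  follows-functional u (inj₂ (cs , refl)) (inj₁ (as , _ , eq))
    with () ← proj₂ (unique-split (_ ∷ cs) as u eq)
  follows-functional u (inj₂ (_ , refl)) (inj₂ (_ , eq)) = ∷-injectiveˡ eq

  follows-injective : ∀ {C v y y′} → Unique C → Follows C y v → Follows C y′ v → y ≡ y′
  follows-injective {v = v} {y} {y′} u (inj₁ (as , bs , refl)) (inj₁ (as′ , bs′ , eq)) =
    ∷ʳ-injectiveʳ as as′ (proj₁ (unique-split (as ∷ʳ y) (as′ ∷ʳ y′)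
      (subst Unique (sym (∷ʳ-++ as y (v ∷ bs))) u)
      (trans (∷ʳ-++ as y (v ∷ bs)) (trans eq (sym (∷ʳ-++ as′ y′ (v ∷ bs′)))))))
  follows-injective {v = v} {y} u (inj₁ (as , bs , refl)) (inj₂ (cs , eq)) =
    ⊥-elim (∷ʳ≢[] as (proj₁ (unique-split (as ∷ʳ y) []
      (subst Unique (sym (∷ʳ-++ as y (v ∷ bs))) u) (trans (∷ʳ-++ as y (v ∷ bs)) eq))))
  follows-injective {v = v} {y} {y′} u (inj₂ (cs , refl)) (inj₁ (as , bs , eq)) =
    ⊥-elim (∷ʳ≢[] as (sym (proj₁ (unique-split [] (as ∷ʳ y′) u
      (trans eq (sym (∷ʳ-++ as y′ (v ∷ bs))))))))
  follows-injective u (inj₂ (cs , refl)) (inj₂ (cs′ , eq)) =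
    proj₂ (∷ʳ-injective cs cs′ (∷-injectiveʳ eq))

  follows-successor : ∀ {C v} → 2 ≤ length C → v ∈ C → ∃ (Follows C v)
  follows-successor _ v∈C with ∈-∃++ v∈C
  follows-successor _ v∈C | as , y ∷ bs , eq = y , inj₁ (as , bs , eq)
  follows-successor _ v∈C | a ∷ as , [] , eq = a , inj₂ (as , eq)
  follows-successor (s≤s ()) v∈C | [] , [] , refl

  follows-predecessor : ∀ {C v} → 2 ≤ length C → v ∈ C → ∃ λ y → Follows C y v
  follows-predecessor {v = v} len v∈C with as , zs , eq ← ∈-∃++ v∈C with initLast as
  ... | as₀ ∷ʳ′ y = y , inj₁ (as₀ , zs , trans eq (∷ʳ-++ as₀ y (v ∷ zs)))
  ... | [] with initLast zs
  ...   | zs₀ ∷ʳ′ y = y , inj₂ (zs₀ , eq)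
  ...   | [] with refl ← eq with s≤s () ← len

  follows-asym : ∀ {C v y} → Unique C → 3 ≤ length C → Follows C v y → ¬ Follows C y v
  follows-asym {v = v} {y} u _ (inj₁ (as , bs , refl)) (inj₁ (as′ , bs′ , eq)) =
    m≢1+n+m (length as′) (trans (sym y-position) (cong suc v-position))
    where
      v-position : length as ≡ suc (length as′)
      v-position = trans (unique-position as (as′ ∷ʳ y) u refl (trans eq (sym (∷ʳ-++ as′ y (v ∷ bs′)))))
                         (length-∷ʳ as′ y)
      y-position : suc (length as) ≡ length as′
      y-position = trans (sym (length-∷ʳ as v)) (unique-position (as ∷ʳ v) as′ u (sym (∷ʳ-++ as v (y ∷ bs))) eq)
  follows-asym u len (inj₁ (as , _ , refl)) (inj₂ (_ , eq)) with unique-position as [] u refl eq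
  follows-asym u (s≤s (s≤s ())) (inj₁ ([] , _ , refl)) (inj₂ ([] , refl)) | refl
  follows-asym u _ (inj₁ ([] , _ , refl)) (inj₂ (c ∷ cs , eq)) | refl
    with () ← unique-position [ _ ] (_ ∷ c ∷ cs) u refl eq
  follows-asym u len (inj₂ (_ , refl)) (inj₁ (as , _ , eq)) with unique-position [] as u refl eq
  follows-asym u (s≤s (s≤s ())) (inj₂ ([] , refl)) (inj₁ ([] , _ , _)) | refl
  follows-asym u _ (inj₂ (c ∷ cs , refl)) (inj₁ ([] , _ , eq)) | refl
    with () ← unique-position (_ ∷ c ∷ cs) [ _ ] u refl eq
  follows-asym u _ (inj₂ (cs , refl)) (inj₂ (cs′ , eq))
    with () ← unique-position [] (_ ∷ cs′) u refl eq

  linked-middle : ∀ {R : V → V → Set} as {y z bs} → Linked R (as ++ y ∷ z ∷ bs) → R y z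
  linked-middle []           (r ∷ _) = r
  linked-middle (_ ∷ [])     (_ ∷ l) = linked-middle [] l
  linked-middle (_ ∷ a ∷ as) (_ ∷ l) = linked-middle (a ∷ as) l

  follows⇒related : ∀ {R : V → V → Set} {x xs y z} →
                    Linked R (x ∷ xs ++ [ x ]) → Follows (x ∷ xs) y z → R y z
  follows⇒related {x = x} {y = y} {z} l (inj₁ (as , bs , eq)) =
    linked-middle as (subst (Linked _) (trans (cong (_++ [ x ]) eq) (++-assoc as (y ∷ z ∷ bs) [ x ])) l)
  follows⇒related {x = x} {xs} {y} l (inj₂ (cs , eq)) with refl , eq′ ← ∷-injective eq =
    linked-middle (x ∷ cs) {bs = []}
      (subst (λ w → Linked _ (x ∷ w)) (trans (cong (_++ [ x ]) eq′) (++-assoc cs [ y ] [ x ])) l)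

  follows-∈ˡ : ∀ {C y z} → Follows C y z → y ∈ C
  follows-∈ˡ (inj₁ (as , _ , refl)) = ∈-++⁺ʳ as (here refl)
  follows-∈ˡ (inj₂ (cs , refl))     = there (∈-++⁺ʳ cs (here refl))

  follows-∈ʳ : ∀ {C y z} → Follows C y z → z ∈ C
  follows-∈ʳ (inj₁ (as , _ , refl)) = ∈-++⁺ʳ as (there (here refl))
  follows-∈ʳ (inj₂ (_ , refl))      = here refl

  module _ {C : List V} (P : V → Set) (closed : ∀ {y z} → Follows C y z → P y → P z) where

    private
      all-from : ∀ as {w r} → C ≡ as ++ w ∷ r → P w → All P (w ∷ r)
      all-from as {r = []}    _  p = p ∷ []
      all-from as {w} {r = w′ ∷ r} eq p =
        p ∷ all-from (as ∷ʳ w) (trans eq (sym (∷ʳ-++ as w (w′ ∷ r)))) (closed (inj₁ (as , r , eq)) p)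

    follows-closed⇒All : ∀ {x} → x ∈ C → P x → All P C
    follows-closed⇒All {x} x∈C p with ∈-∃++ x∈C
    ... | [] , _ , eq = subst (All P) (sym eq) (all-from [] eq p)
    ... | a ∷ as , zs , eq with initLast zs
    ...   | [] = subst (All P) (sym eq) (all-from [] eq (closed (inj₂ (as , eq)) p))
    ...   | zs₀ ∷ʳ′ l = subst (All P) (sym eq) (all-from [] eq (closed (inj₂ (as ++ x ∷ zs₀ , eq′)) pl))
      where
        eq′ : C ≡ a ∷ (as ++ x ∷ zs₀) ∷ʳ l
        eq′ = trans eq (cong (a ∷_) (sym (++-assoc as (x ∷ zs₀) [ l ])))
        pl : P l
        pl = All.lookup (all-from (a ∷ as) eq p) (there (∈-++⁺ʳ zs₀ (here refl)))

module _ {V : Set} where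

  Consecutive : List V → V → V → Set
  Consecutive C y z = Follows C y z ⊎ Follows C z y

  consecutive-sym : ∀ {C y z} → Consecutive C y z → Consecutive C z y
  consecutive-sym (inj₁ f) = inj₂ f
  consecutive-sym (inj₂ f) = inj₁ f

  consecutive-∈ : ∀ {C y z} → Consecutive C y z → y ∈ C
  consecutive-∈ (inj₁ f) = follows-∈ˡ f
  consecutive-∈ (inj₂ f) = follows-∈ʳ f

  DegreeTwo : (V → V → Set) → V → Set
  DegreeTwo F v = ∃₂ λ y z → y ≢ z × F v y × F v z × (∀ w → F v w → w ≡ y ⊎ w ≡ z)

  Closed : (V → V → Set) → (V → Set) → Set
  Closed F P = ∀ {x y} → F x y → P x → P y

  module _ {Adj : V → V → Set} where

    cycle-consecutive⇒adj : (∀ {x y} → Adj x y → Adj y x) →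
                            ∀ {C y z} → IsCycle Adj C → Consecutive C y z → Adj y z
    cycle-consecutive⇒adj _   {x ∷ xs} (_ , _ , l) (inj₁ f) = follows⇒related l f
    cycle-consecutive⇒adj sym {x ∷ xs} (_ , _ , l) (inj₂ f) = sym (follows⇒related l f)

    cycle-degreeTwo : ∀ {C v} → IsCycle Adj C → v ∈ C → DegreeTwo (Consecutive C) v
    cycle-degreeTwo {x ∷ xs} {v} (len , u , _) v∈C
      with y , v→y ← follows-successor (≤-trans (n≤1+n 2) len) v∈C
         | z , z→v ← follows-predecessor (≤-trans (n≤1+n 2) len) v∈C =
      y , z , y≢z , inj₁ v→y , inj₂ z→v , only
      where
        y≢z : y ≢ z
        y≢z refl = follows-asym u len v→y z→v
        only : ∀ w → Consecutive (x ∷ xs) v w → w ≡ y ⊎ w ≡ z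
        only w (inj₁ v→w) = inj₁ (follows-functional u v→w v→y)
        only w (inj₂ w→v) = inj₂ (follows-injective u w→v z→v)

module TwoFactor {V : Set} {Adj : V → V → Set} (Adj-sym : ∀ {x y} → Adj x y → Adj y x)
                 {C₁ C₂ : List V} (factor : IsTwoCycleTwoFactor Adj C₁ C₂) where

  private
    cycle₁ : IsCycle Adj C₁
    cycle₁ = proj₁ factor
    cycle₂ : IsCycle Adj C₂
    cycle₂ = proj₁ (proj₂ factor)

  disjoint : ∀ v → v ∈ C₁ → v ∉ C₂
  disjoint = proj₁ (proj₂ (proj₂ factor))

  covering : ∀ v → v ∈ C₁ ⊎ v ∈ C₂
  covering = proj₂ (proj₂ (proj₂ factor))

  InFactor : V → V → Set
  InFactor y z = Consecutive C₁ y z ⊎ Consecutive C₂ y z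

  inFactor-sym : ∀ {x y} → InFactor x y → InFactor y x
  inFactor-sym (inj₁ e) = inj₁ (consecutive-sym e)
  inFactor-sym (inj₂ e) = inj₂ (consecutive-sym e)

  inFactor⇒adj : ∀ {x y} → InFactor x y → Adj x y
  inFactor⇒adj (inj₁ e) = cycle-consecutive⇒adj Adj-sym cycle₁ e
  inFactor⇒adj (inj₂ e) = cycle-consecutive⇒adj Adj-sym cycle₂ e

  inFactor-closed₁ : Closed InFactor (_∈ C₁)
  inFactor-closed₁ (inj₁ e) _ = consecutive-∈ (consecutive-sym e)
  inFactor-closed₁ {x} (inj₂ e) x∈C₁ = ⊥-elim (disjoint x x∈C₁ (consecutive-∈ e))

  inFactor-closed₂ : Closed InFactor (_∈ C₂)
  inFactor-closed₂ (inj₂ e) _ = consecutive-∈ (consecutive-sym e)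
  inFactor-closed₂ {x} (inj₁ e) x∈C₂ = ⊥-elim (disjoint x (consecutive-∈ e) x∈C₂)

  inFactor-degreeTwo : ∀ v → DegreeTwo InFactor v
  inFactor-degreeTwo v with covering v
  ... | inj₁ v∈C₁ with y , z , y≢z , vy , vz , only ← cycle-degreeTwo cycle₁ v∈C₁ =
    y , z , y≢z , inj₁ vy , inj₁ vz , λ where
      w (inj₁ vw) → only w vw
      w (inj₂ vw) → ⊥-elim (disjoint v v∈C₁ (consecutive-∈ vw))
  ... | inj₂ v∈C₂ with y , z , y≢z , vy , vz , only ← cycle-degreeTwo cycle₂ v∈C₂ =
    y , z , y≢z , inj₂ vy , inj₂ vz , λ where
      w (inj₁ vw) → ⊥-elim (disjoint v (consecutive-∈ vw) v∈C₂)
      w (inj₂ vw) → only w vw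

  closed⇒all-∈₁ : ∀ {P} → Closed InFactor P → ∀ {x} → x ∈ C₁ → P x → ∀ {w} → w ∈ C₁ → P w
  closed⇒all-∈₁ {P} closed x∈C₁ p w∈C₁ =
    All.lookup (follows-closed⇒All P (λ f → closed (inj₁ (inj₁ f))) x∈C₁ p) w∈C₁

  closed⇒all-∈₂ : ∀ {P} → Closed InFactor P → ∀ {x} → x ∈ C₂ → P x → ∀ {w} → w ∈ C₂ → P w
  closed⇒all-∈₂ {P} closed x∈C₂ p w∈C₂ =
    All.lookup (follows-closed⇒All P (λ f → closed (inj₂ (inj₁ f))) x∈C₂ p) w∈C₂

data ExactlyTwo (P Q R : Set) : Set where
  without₁ : ¬ P → Q → R → ExactlyTwo P Q R
  without₂ : P → ¬ Q → R → ExactlyTwo P Q R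
  without₃ : P → Q → ¬ R → ExactlyTwo P Q R

ExactlyOne : Set → Set → Set
ExactlyOne P Q = (P × ¬ Q) ⊎ (¬ P × Q)

module _ {P Q R : Set} where

  exactlyTwo-¬₁ : ExactlyTwo P Q R → ¬ P → Q × R
  exactlyTwo-¬₁ (without₁ _ q r) _  = q , r
  exactlyTwo-¬₁ (without₂ p _ _) ¬p = ⊥-elim (¬p p)
  exactlyTwo-¬₁ (without₃ p _ _) ¬p = ⊥-elim (¬p p)

  exactlyTwo-¬₂ : ExactlyTwo P Q R → ¬ Q → P × R
  exactlyTwo-¬₂ (without₁ _ q _) ¬q = ⊥-elim (¬q q)
  exactlyTwo-¬₂ (without₂ p _ r) _  = p , r
  exactlyTwo-¬₂ (without₃ _ q _) ¬q = ⊥-elim (¬q q)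

  exactlyTwo-¬₃ : ExactlyTwo P Q R → ¬ R → P × Q
  exactlyTwo-¬₃ (without₁ _ _ r) ¬r = ⊥-elim (¬r r)
  exactlyTwo-¬₃ (without₂ _ _ r) ¬r = ⊥-elim (¬r r)
  exactlyTwo-¬₃ (without₃ p q _) _  = p , q

  exactlyTwo-₂₃ : ExactlyTwo P Q R → Q → R → ¬ P
  exactlyTwo-₂₃ (without₁ ¬p _ _) _ _ = ¬p
  exactlyTwo-₂₃ (without₂ _ ¬q _) q _ = ⊥-elim (¬q q)
  exactlyTwo-₂₃ (without₃ _ _ ¬r) _ r = ⊥-elim (¬r r)

  exactlyTwo-₁ : ExactlyTwo P Q R → P → ExactlyOne Q R
  exactlyTwo-₁ (without₁ ¬p _ _) p = ⊥-elim (¬p p)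
  exactlyTwo-₁ (without₂ _ ¬q r) _ = inj₂ (¬q , r)
  exactlyTwo-₁ (without₃ _ q ¬r) _ = inj₁ (q , ¬r)

module _ {V : Set} (F : V → V → Set) where

  private
    absent-from : ∀ {v y z} → (∀ w → F v w → w ≡ y ⊎ w ≡ z) → ∀ {w} → w ≢ y → w ≢ z → ¬ F v w
    absent-from only w≢y w≢z vw with only _ vw
    ... | inj₁ w≡y = w≢y w≡y
    ... | inj₂ w≡z = w≢z w≡z

  degreeTwo⇒exactlyTwo : ∀ {v p q r} → DegreeTwo F v → p ≢ q → p ≢ r → q ≢ r →
                         (∀ w → F v w → w ≡ p ⊎ w ≡ q ⊎ w ≡ r) → ExactlyTwo (F v p) (F v q) (F v r)
  degreeTwo⇒exactlyTwo {v} {p} {q} {r} (y , z , y≢z , vy , vz , only) p≢q p≢r q≢r among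
    with among y vy | among z vz
  ... | inj₁ refl        | inj₁ refl        = ⊥-elim (y≢z refl)
  ... | inj₂ (inj₁ refl) | inj₂ (inj₁ refl) = ⊥-elim (y≢z refl)
  ... | inj₂ (inj₂ refl) | inj₂ (inj₂ refl) = ⊥-elim (y≢z refl)
  ... | inj₁ refl        | inj₂ (inj₁ refl) = without₃ vy vz (absent-from only (≢-sym p≢r) (≢-sym q≢r))
  ... | inj₂ (inj₁ refl) | inj₁ refl        = without₃ vz vy (absent-from only (≢-sym q≢r) (≢-sym p≢r))
  ... | inj₁ refl        | inj₂ (inj₂ refl) = without₂ vy (absent-from only (≢-sym p≢q) q≢r) vz
  ... | inj₂ (inj₂ refl) | inj₁ refl        = without₂ vz (absent-from only q≢r (≢-sym p≢q)) vy
  ... | inj₂ (inj₁ refl) | inj₂ (inj₂ refl) = without₁ (absent-from only p≢q p≢r) vy vz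
  ... | inj₂ (inj₂ refl) | inj₂ (inj₁ refl) = without₁ (absent-from only p≢r p≢q) vz vy

  closed-path : ∀ {P w x y z} → (∀ {s t} → F s t → F t s) → Closed F P →
                F w x → F x y → F y z → P x ⊎ P z → P w × P x × P y × P z
  closed-path sym closed wx xy yz (inj₁ px) = closed (sym wx) px , px , closed xy px , closed yz (closed xy px)
  closed-path sym closed wx xy yz (inj₂ pz) =
    closed-path sym closed wx xy yz (inj₁ (closed (sym xy) (closed (sym yz) pz)))

module Square {V : Set} (F : V → V → Set) (F-sym : ∀ {x y} → F x y → F y x)
  {a b c d a′ b′ c′ d′ : V}
  (at-a : ExactlyTwo (F a a′) (F a b) (F a d)) (at-b : ExactlyTwo (F b b′) (F b a) (F b c))
  (at-c : ExactlyTwo (F c c′) (F c d) (F c b)) (at-d : ExactlyTwo (F d d′) (F d c) (F d a)) where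

  square-isolated : ¬ F a a′ → ¬ F c c′ → ¬ F b b′ × ¬ F d d′
  square-isolated ¬aa′ ¬cc′ with ab , ad ← exactlyTwo-¬₁ at-a ¬aa′ | cd , cb ← exactlyTwo-¬₁ at-c ¬cc′ =
    exactlyTwo-₂₃ at-b (F-sym ab) (F-sym cb) , exactlyTwo-₂₃ at-d (F-sym cd) (F-sym ad)

  private
    path : ∀ {P w x y z} → Closed F P → F w x → F x y → F y z → P x ⊎ P z → P w × P x × P y × P z
    path = closed-path F F-sym

  Spanned : Set₁
  Spanned = ∀ {P} → Closed F P → P a ⊎ P c → P a × P b × P c × P d

  square-traversed : ExactlyOne (F a a′) (F c c′) → ExactlyOne (F b b′) (F d d′) × Spanned
  square-traversed (inj₂ (¬aa′ , cc′)) with ab , ad ← exactlyTwo-¬₁ at-a ¬aa′ with exactlyTwo-₁ at-c cc′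
  ... | inj₁ (cd , ¬cb) =
    inj₁ (proj₁ (exactlyTwo-¬₃ at-b (λ bc → ¬cb (F-sym bc))) , exactlyTwo-₂₃ at-d (F-sym cd) (F-sym ad)) ,
    λ closed entry → let pb , pa , pd , pc = path closed (F-sym ab) ad (F-sym cd) entry
                     in pa , pb , pc , pd
  ... | inj₂ (¬cd , cb) =
    inj₂ (exactlyTwo-₂₃ at-b (F-sym ab) (F-sym cb) , proj₁ (exactlyTwo-¬₂ at-d (λ dc → ¬cd (F-sym dc)))) ,
    λ closed entry → let pd , pa , pb , pc = path closed (F-sym ad) ab (F-sym cb) entry
                     in pa , pb , pc , pd
  square-traversed (inj₁ (aa′ , ¬cc′)) with cd , cb ← exactlyTwo-¬₁ at-c ¬cc′ with exactlyTwo-₁ at-a aa′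
  ... | inj₁ (ab , ¬ad) =
    inj₂ (exactlyTwo-₂₃ at-b (F-sym ab) (F-sym cb) , proj₁ (exactlyTwo-¬₃ at-d (λ da → ¬ad (F-sym da)))) ,
    λ closed entry → let pd , pc , pb , pa = path closed (F-sym cd) cb (F-sym ab) (swap entry)
                     in pa , pb , pc , pd
  ... | inj₂ (¬ab , ad) =
    inj₁ (proj₁ (exactlyTwo-¬₂ at-b (λ ba → ¬ab (F-sym ba))) , exactlyTwo-₂₃ at-d (F-sym cd) (F-sym ad)) ,
    λ closed entry → let pb , pc , pd , pa = path closed (F-sym cb) cd (F-sym ad) (swap entry)
                     in pa , pb , pc , pd

HTG-sym : ∀ {m n ℓ u v} → HTG m n ℓ u v → HTG m n ℓ v u
HTG-sym (u≢v , inj₁ uv) = ≢-sym u≢v , inj₂ uv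
HTG-sym (u≢v , inj₂ vu) = ≢-sym u≢v , inj₁ vu

ModEq⇒%≡ : ∀ {p a b} .{{_ : NonZero p}} → ModEq p a b → a % p ≡ b % p
ModEq⇒%≡ {p} {b = b} (k , inj₁ refl) = [m+kn]%n≡m%n b k p
ModEq⇒%≡ {p} {a}     (k , inj₂ refl) = sym ([m+kn]%n≡m%n a k p)

%-+-congʳ : ∀ {s t} b n .{{_ : NonZero n}} → s % n ≡ t % n → (s + b) % n ≡ (t + b) % n
%-+-congʳ {s} {t} b n eq = begin
  (s + b) % n             ≡⟨ %-distribˡ-+ s b n ⟩
  (s % n + b % n) % n     ≡⟨ cong (λ r → (r + b % n) % n) eq ⟩
  (t % n + b % n) % n     ≡⟨ %-distribˡ-+ t b n ⟨
  (t + b) % n             ∎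
  where open ≡-Reasoning

%-suc-cancel : ∀ {x y} n .{{_ : NonZero n}} → suc x % n ≡ suc y % n → x % n ≡ y % n
%-suc-cancel {x} {y} n@(suc n₁) eq = begin
  x % n             ≡⟨ [m+n]%n≡m%n x n ⟨
  (x + suc n₁) % n  ≡⟨ cong (_% n) (+-suc x n₁) ⟩
  (suc x + n₁) % n  ≡⟨ %-+-congʳ {suc x} {suc y} n₁ n eq ⟩
  (suc y + n₁) % n  ≡⟨ cong (_% n) (+-suc y n₁) ⟨
  (y + suc n₁) % n  ≡⟨ [m+n]%n≡m%n y n ⟩
  y % n             ∎
  where open ≡-Reasoning

%-+-cancelʳ : ∀ {x y} c n .{{_ : NonZero n}} → (x + c) % n ≡ (y + c) % n → x % n ≡ y % n
%-+-cancelʳ {x} {y} zero    n eq = subst₂ (λ x′ y′ → x′ % n ≡ y′ % n) (+-identityʳ x) (+-identityʳ y) eq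
%-+-cancelʳ {x} {y} (suc c) n eq =
  %-+-cancelʳ c n (%-suc-cancel n (subst₂ (λ x′ y′ → x′ % n ≡ y′ % n) (+-suc x c) (+-suc y c) eq))

r≢[r+δ]%n : ∀ {r δ} n .{{_ : NonZero n}} → r < n → 0 < δ → δ < n → r ≢ (r + δ) % n
r≢[r+δ]%n {r} {δ} n r<n 0<δ δ<n r≡[r+δ]%n with <-≤-connex (r + δ) n
... | inj₁ r+δ<n = <-irrefl δ≡0 0<δ
  where
    δ≡0 : 0 ≡ δ
    δ≡0 = sym (+-cancelˡ-≡ r δ 0 (trans (sym (trans r≡[r+δ]%n (m<n⇒m%n≡m r+δ<n))) (sym (+-identityʳ r))))
... | inj₂ n≤r+δ = <-irrefl δ≡n δ<n
  where
    s = r + δ ∸ n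
    s+n≡r+δ : s + n ≡ r + δ
    s+n≡r+δ = m∸n+n≡m n≤r+δ
    s<n : s < n
    s<n = +-cancelʳ-< n s n (subst (_< n + n) (sym s+n≡r+δ) (+-mono-<-≤ r<n (<⇒≤ δ<n)))
    r≡s : r ≡ s
    r≡s = trans r≡[r+δ]%n (trans (cong (_% n) (sym s+n≡r+δ)) (trans ([m+n]%n≡m%n s n) (m<n⇒m%n≡m s<n)))
    δ≡n : δ ≡ n
    δ≡n = +-cancelˡ-≡ r δ n (trans (sym s+n≡r+δ) (cong (_+ n) (sym r≡s)))

module Column (n : ℕ) .{{_ : NonZero n}} where

  vertex : ℕ → Vertex 1 n
  vertex t = zero , fromℕ< (m%n<n t n)

  toℕ-vertex : ∀ t → toℕ (proj₂ (vertex t)) ≡ t % n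
  toℕ-vertex t = toℕ-fromℕ< (m%n<n t n)

  vertex-cong : ∀ {s t} → s % n ≡ t % n → vertex s ≡ vertex t
  vertex-cong {s} {t} eq = cong (zero ,_) (toℕ-injective (trans (toℕ-vertex s) (trans eq (sym (toℕ-vertex t)))))

  vertex-% : ∀ {s t} → vertex s ≡ vertex t → s % n ≡ t % n
  vertex-% {s} {t} eq = trans (sym (toℕ-vertex s)) (trans (cong (toℕ ∘ proj₂) eq) (toℕ-vertex t))

  vertex-toℕ : ∀ j → (zero , j) ≡ vertex (toℕ j)
  vertex-toℕ j = cong (zero ,_) (toℕ-injective (sym (trans (toℕ-vertex (toℕ j)) (m<n⇒m%n≡m (toℕ<n j)))))

  vertex-≢ : ∀ x y {δ} → 0 < δ → δ < n → x + δ ≡ y → vertex x ≢ vertex y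
  vertex-≢ x _ {δ} 0<δ δ<n refl eq =
    r≢[r+δ]%n n (m%n<n x n) 0<δ δ<n (trans (vertex-% eq) (%-+-congʳ δ n (sym (m%n%n≡m%n x n))))

module Neighbours (n ℓ : ℕ) .{{_ : NonZero n}} (2∣n : 2 ∣ n) (ℓ-odd : ℓ % 2 ≡ 1) where

  open Column n

  private
    %n%2 : ∀ t → t % n % 2 ≡ t % 2
    %n%2 t = m∣n⇒o%n%m≡o%m 2 n t 2∣n

    residue : ∀ {t x} → ModEq n (toℕ (proj₂ (vertex t))) x → t % n ≡ x % n
    residue {t} me = trans (sym (m%n%n≡m%n t n)) (trans (cong (_% n) (sym (toℕ-vertex t))) (ModEq⇒%≡ me))

    forward : ∀ t (j : Fin n) b → ModEq n (toℕ j) (toℕ (proj₂ (vertex t)) + b) → (zero , j) ≡ vertex (t + b)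
    forward t j b me = trans (vertex-toℕ j) (vertex-cong (begin
      toℕ j % n                         ≡⟨ ModEq⇒%≡ me ⟩
      (toℕ (proj₂ (vertex t)) + b) % n  ≡⟨ %-+-congʳ b n (trans (cong (_% n) (toℕ-vertex t)) (m%n%n≡m%n t n)) ⟩
      (t + b) % n                       ∎))
      where open ≡-Reasoning

    backward : ∀ t (j : Fin n) {b p} → (p + b) % n ≡ t % n → ModEq n (toℕ (proj₂ (vertex t))) (toℕ j + b) →
               (zero , j) ≡ vertex p
    backward t j {b} p+b≈t me =
      trans (vertex-toℕ j) (vertex-cong (%-+-cancelʳ b n (trans (sym (residue me)) (sym p+b≈t))))

    jump-source-odd : ∀ t → Odd (toℕ (proj₂ (vertex t))) → t % 2 ≡ 1
    jump-source-odd t odd = trans (sym (%n%2 t)) (trans (cong (_% 2) (sym (toℕ-vertex t))) (ModEq⇒%≡ odd))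

    jump-target-even : ∀ t (j : Fin n) → Odd (toℕ j) → ModEq n (toℕ (proj₂ (vertex t))) (toℕ j + ℓ) → t % 2 ≡ 0
    jump-target-even t j j-odd me = begin
      t % 2                       ≡⟨ %n%2 t ⟨
      t % n % 2                   ≡⟨ cong (_% 2) (residue me) ⟩
      (toℕ j + ℓ) % n % 2         ≡⟨ %n%2 (toℕ j + ℓ) ⟩
      (toℕ j + ℓ) % 2             ≡⟨ %-distribˡ-+ (toℕ j) ℓ 2 ⟩
      (toℕ j % 2 + ℓ % 2) % 2     ≡⟨ cong₂ (λ x y → (x + y) % 2) (ModEq⇒%≡ j-odd) ℓ-odd ⟩
      0                           ∎
      where open ≡-Reasoning

  -- p and q may be any representatives of t - 1 and t - ℓ, so callers can choose syntactically convenient ones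
  even-neighbours : ∀ {t p q w} → t % 2 ≡ 0 → suc p % n ≡ t % n → (q + ℓ) % n ≡ t % n →
                    HTG 1 n ℓ (vertex t) w → w ≡ vertex p ⊎ w ≡ vertex (suc t) ⊎ w ≡ vertex q
  even-neighbours {t} {w = zero , j} _ _ _ (_ , inj₁ (inj₁ (_ , me))) =
    inj₂ (inj₁ (trans (forward t j 1 me) (cong vertex (+-comm t 1))))
  even-neighbours {w = zero , _} _ _ _ (_ , inj₁ (inj₂ (inj₁ (() , _))))
  even-neighbours {t} even _ _ (_ , inj₁ (inj₂ (inj₂ (_ , _ , odd , _)))) with () ← trans (sym even) (jump-source-odd t odd)
  even-neighbours {t} {p} {w = zero , j} _ 1+p≈t _ (_ , inj₂ (inj₁ (_ , me))) =
    inj₁ (backward t j (trans (cong (_% n) (+-comm p 1)) 1+p≈t) me)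
  even-neighbours {w = zero , _} _ _ _ (_ , inj₂ (inj₂ (inj₁ (() , _))))
  even-neighbours {t} {w = zero , j} _ _ q+ℓ≈t (_ , inj₂ (inj₂ (inj₂ (_ , _ , _ , me)))) =
    inj₂ (inj₂ (backward t j q+ℓ≈t me))

  odd-neighbours : ∀ {t p w} → t % 2 ≡ 1 → suc p % n ≡ t % n →
                   HTG 1 n ℓ (vertex t) w → w ≡ vertex (suc t) ⊎ w ≡ vertex p ⊎ w ≡ vertex (t + ℓ)
  odd-neighbours {t} {w = zero , j} _ _ (_ , inj₁ (inj₁ (_ , me))) =
    inj₁ (trans (forward t j 1 me) (cong vertex (+-comm t 1)))
  odd-neighbours {w = zero , _} _ _ (_ , inj₁ (inj₂ (inj₁ (() , _))))
  odd-neighbours {t} {w = zero , j} _ _ (_ , inj₁ (inj₂ (inj₂ (_ , _ , _ , me)))) = inj₂ (inj₂ (forward t j _ me))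
  odd-neighbours {t} {p} {w = zero , j} _ 1+p≈t (_ , inj₂ (inj₁ (_ , me))) =
    inj₂ (inj₁ (backward t j (trans (cong (_% n) (+-comm p 1)) 1+p≈t) me))
  odd-neighbours {w = zero , _} _ _ (_ , inj₂ (inj₂ (inj₁ (() , _))))
  odd-neighbours {t} {w = zero , j} odd _ (_ , inj₂ (inj₂ (inj₂ (_ , _ , j-odd , me))))
    with () ← trans (sym (jump-target-even t j j-odd me)) odd

-- HTG(1, n, ℓ) for n = 4 (k + 3) and ℓ = (n - 2) / 2
module Ladder (k : ℕ) where

  ℓ n : ℕ
  ℓ = 5 + k * 2
  n = 12 + k * 4

  open Column n public
  open Neighbours n ℓ (∣-trans (divides 2 refl) (divides (3 + k) refl)) ([m+kn]%n≡m%n 1 (2 + k) 2)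

  G : Vertex 1 n → Vertex 1 n → Set
  G = HTG 1 n ℓ

  full-turn : ∀ y → (2 + (y + ℓ) + ℓ) % n ≡ y % n
  full-turn y = trans (cong (_% n) (two-jumps y k)) ([m+n]%n≡m%n y n)
    where
      two-jumps : ∀ y k → 2 + (y + (5 + k * 2)) + (5 + k * 2) ≡ y + (12 + k * 4)
      two-jumps = solve-∀

  base : ℕ → ℕ
  base i = 1 + i * 2

  -- A i, B i, C i, D i span a 4-cycle (vertical edges AB, CD and jump edges BC, DA); the remaining
  -- neighbours are A′ i = B (i - 1), B′ i = A (i + 1), C′ i = D (i - 1), D′ i = C (i + 1).
  A B C D A′ B′ C′ D′ : ℕ → Vertex 1 n
  A′ i = vertex (base i)
  A  i = vertex (1 + base i)
  B  i = vertex (2 + base i)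
  B′ i = A (suc i)
  C′ i = vertex (1 + (base i + ℓ))
  C  i = vertex (2 + (base i + ℓ))
  D  i = vertex (3 + (base i + ℓ))
  D′ i = C (suc i)

  private
    suc-odd : ∀ t → t % 2 ≡ 1 → suc t % 2 ≡ 0
    suc-odd t t-odd = trans (%-distribˡ-+ 1 t 2) (cong (λ r → (1 + r) % 2) t-odd)

    suc-even : ∀ t → t % 2 ≡ 0 → suc t % 2 ≡ 1
    suc-even t t-even = trans (%-distribˡ-+ 1 t 2) (cong (λ r → (1 + r) % 2) t-even)

    base-odd : ∀ i → base i % 2 ≡ 1
    base-odd i = [m+kn]%n≡m%n 1 i 2

    base+ℓ-even : ∀ i → (base i + ℓ) % 2 ≡ 0
    base+ℓ-even i = trans (%-distribˡ-+ (base i) ℓ 2)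
      (cong₂ (λ r s → (r + s) % 2) (base-odd i) ([m+kn]%n≡m%n 1 (2 + k) 2))

  A-neighbours : ∀ i {w} → G (A i) w → w ≡ A′ i ⊎ w ≡ B i ⊎ w ≡ D i
  A-neighbours i = even-neighbours {1 + base i} {base i} {3 + (base i + ℓ)}
    (suc-odd (base i) (base-odd i)) refl (full-turn (1 + base i))

  B-neighbours : ∀ i {w} → G (B i) w → w ≡ B′ i ⊎ w ≡ A i ⊎ w ≡ C i
  B-neighbours i = odd-neighbours {2 + base i} {1 + base i}
    (suc-even (1 + base i) (suc-odd (base i) (base-odd i))) refl

  C-neighbours : ∀ i {w} → G (C i) w → w ≡ C′ i ⊎ w ≡ D i ⊎ w ≡ B i
  C-neighbours i = even-neighbours {2 + (base i + ℓ)} {1 + (base i + ℓ)} {2 + base i}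
    (suc-odd (1 + (base i + ℓ)) (suc-even (base i + ℓ) (base+ℓ-even i))) refl refl

  D-neighbours : ∀ i {w} → G (D i) w → w ≡ D′ i ⊎ w ≡ C i ⊎ w ≡ A i
  D-neighbours i dw = map₂ (map₂ (λ e → trans e (vertex-cong {3 + (base i + ℓ) + ℓ} {1 + base i} (full-turn (1 + base i)))))
    (odd-neighbours {3 + (base i + ℓ)} {2 + (base i + ℓ)}
      (suc-even (2 + (base i + ℓ)) (suc-odd (1 + (base i + ℓ)) (suc-even (base i + ℓ) (base+ℓ-even i)))) refl dw)

  private
    4+ℓ<n : 4 + ℓ < n
    4+ℓ<n = +-mono-<-≤ (m≤m+n 10 2) (*-monoʳ-≤ k (m≤m+n 2 2))

    offset-≢ : ∀ y o o′ → o < o′ → o′ ≤ 4 + ℓ → vertex (o + y) ≢ vertex (o′ + y)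
    offset-≢ y o o′ o<o′ o′≤4+ℓ = vertex-≢ (o + y) (o′ + y) (m<n⇒0<n∸m o<o′)
      (≤-<-trans (m∸n≤m o′ o) (≤-<-trans o′≤4+ℓ 4+ℓ<n)) (begin
        o + y + (o′ ∸ o)   ≡⟨ +-assoc o y (o′ ∸ o) ⟩
        o + (y + (o′ ∸ o)) ≡⟨ cong (o +_) (+-comm y (o′ ∸ o)) ⟩
        o + ((o′ ∸ o) + y) ≡⟨ +-assoc o (o′ ∸ o) y ⟨
        o + (o′ ∸ o) + y   ≡⟨ cong (_+ y) (m+[n∸m]≡n (<⇒≤ o<o′)) ⟩
        o′ + y             ∎)
      where open ≡-Reasoning

  near-≢ : ∀ y o o′ → o < o′ → o′ ≤ 4 → vertex (o + y) ≢ vertex (o′ + y)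
  near-≢ y o o′ o<o′ o′≤4 = offset-≢ y o o′ o<o′ (≤-trans o′≤4 (m≤m+n 4 ℓ))

  across-≢ : ∀ y j j′ → j ≤ 3 → j′ ≤ 4 → vertex (j + y) ≢ vertex (j′ + (y + ℓ))
  across-≢ y j j′ j≤3 j′≤4 = subst (λ z → vertex (j + y) ≢ vertex z) (sym rearrange)
    (offset-≢ y j (j′ + ℓ) (≤-trans (s≤s j≤3) (≤-trans (m≤m+n 4 (1 + k * 2)) (m≤n+m ℓ j′))) (+-monoˡ-≤ ℓ j′≤4))
    where
      rearrange : j′ + (y + ℓ) ≡ j′ + ℓ + y
      rearrange = trans (cong (j′ +_) (+-comm y ℓ)) (sym (+-assoc j′ ℓ y))

  module _ {C₁ C₂ : List (Vertex 1 n)} (factor : IsTwoCycleTwoFactor G C₁ C₂)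
           (1∈C₁ : vertex 1 ∈ C₁) (2∈C₂ : vertex 2 ∈ C₂) where

    open TwoFactor HTG-sym factor

    at-A : ∀ i → ExactlyTwo (InFactor (A i) (A′ i)) (InFactor (A i) (B i)) (InFactor (A i) (D i))
    at-A i = degreeTwo⇒exactlyTwo InFactor (inFactor-degreeTwo (A i))
      (near-≢ (base i) 0 2 (s≤s z≤n) (s≤s (s≤s z≤n)))
      (across-≢ (base i) 0 3 z≤n (s≤s (s≤s (s≤s z≤n))))
      (across-≢ (base i) 2 3 (s≤s (s≤s z≤n)) (s≤s (s≤s (s≤s z≤n))))
      (λ _ e → A-neighbours i (inFactor⇒adj e))

    at-B : ∀ i → ExactlyTwo (InFactor (B i) (B′ i)) (InFactor (B i) (A i)) (InFactor (B i) (C i))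
    at-B i = degreeTwo⇒exactlyTwo InFactor (inFactor-degreeTwo (B i))
      (≢-sym (near-≢ (base i) 1 3 (s≤s (s≤s z≤n)) (s≤s (s≤s (s≤s z≤n)))))
      (across-≢ (base i) 3 2 (s≤s (s≤s (s≤s z≤n))) (s≤s (s≤s z≤n)))
      (across-≢ (base i) 1 2 (s≤s z≤n) (s≤s (s≤s z≤n)))
      (λ _ e → B-neighbours i (inFactor⇒adj e))

    at-C : ∀ i → ExactlyTwo (InFactor (C i) (C′ i)) (InFactor (C i) (D i)) (InFactor (C i) (B i))
    at-C i = degreeTwo⇒exactlyTwo InFactor (inFactor-degreeTwo (C i))
      (near-≢ (base i + ℓ) 1 3 (s≤s (s≤s z≤n)) (s≤s (s≤s (s≤s z≤n))))
      (≢-sym (across-≢ (base i) 2 1 (s≤s (s≤s z≤n)) (s≤s z≤n)))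
      (≢-sym (across-≢ (base i) 2 3 (s≤s (s≤s z≤n)) (s≤s (s≤s (s≤s z≤n)))))
      (λ _ e → C-neighbours i (inFactor⇒adj e))

    at-D : ∀ i → ExactlyTwo (InFactor (D i) (D′ i)) (InFactor (D i) (C i)) (InFactor (D i) (A i))
    at-D i = degreeTwo⇒exactlyTwo InFactor (inFactor-degreeTwo (D i))
      (≢-sym (near-≢ (base i + ℓ) 2 4 (s≤s (s≤s (s≤s z≤n))) (s≤s (s≤s (s≤s (s≤s z≤n))))))
      (≢-sym (across-≢ (base i) 1 4 (s≤s z≤n) (s≤s (s≤s (s≤s (s≤s z≤n))))))
      (≢-sym (across-≢ (base i) 1 2 (s≤s z≤n) (s≤s (s≤s z≤n))))
      (λ _ e → D-neighbours i (inFactor⇒adj e))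

    module SquareAt (i : ℕ) = Square InFactor inFactor-sym (at-A i) (at-B i) (at-C i) (at-D i)

    last : ℕ
    last = 2 + k

    C-last : C last ≡ vertex 0
    C-last = vertex-cong {2 + (ℓ + ℓ)} {0} (full-turn 0)

    D-last : D last ≡ vertex 1
    D-last = vertex-cong {3 + (ℓ + ℓ)} {1} (full-turn 1)

    ¬A₀A′₀ : ¬ InFactor (A 0) (A′ 0)
    ¬A₀A′₀ e = disjoint (vertex 1) 1∈C₁ (inFactor-closed₂ e 2∈C₂)

    Isolated : ℕ → Set
    Isolated i = ¬ InFactor (A i) (A′ i) × ¬ InFactor (C i) (C′ i)

    isolated : Isolated 0 → ∀ i → Isolated i
    isolated iso₀ zero = iso₀
    isolated iso₀ (suc i) with ¬bb′ , ¬dd′ ← uncurry (SquareAt.square-isolated i) (isolated iso₀ i) =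
      ¬bb′ ∘ inFactor-sym , ¬dd′ ∘ inFactor-sym

    InSquare : ℕ → Vertex 1 n → Set
    InSquare i v = v ≡ A i ⊎ v ≡ B i ⊎ v ≡ C i ⊎ v ≡ D i

    isolated-square-closed : Isolated 0 → ∀ i → Closed InFactor (InSquare i)
    isolated-square-closed iso₀ i {y = y} e (inj₁ refl) with A-neighbours i (inFactor⇒adj e)
    ... | inj₁ refl = ⊥-elim (proj₁ (isolated iso₀ i) e)
    ... | inj₂ (inj₁ y≡b) = inj₂ (inj₁ y≡b)
    ... | inj₂ (inj₂ y≡d) = inj₂ (inj₂ (inj₂ y≡d))
    isolated-square-closed iso₀ i {y = y} e (inj₂ (inj₁ refl)) with B-neighbours i (inFactor⇒adj e)
    ... | inj₁ refl = ⊥-elim (proj₁ (isolated iso₀ (suc i)) (inFactor-sym e))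
    ... | inj₂ (inj₁ y≡a) = inj₁ y≡a
    ... | inj₂ (inj₂ y≡c) = inj₂ (inj₂ (inj₁ y≡c))
    isolated-square-closed iso₀ i {y = y} e (inj₂ (inj₂ (inj₁ refl))) with C-neighbours i (inFactor⇒adj e)
    ... | inj₁ refl = ⊥-elim (proj₂ (isolated iso₀ i) e)
    ... | inj₂ (inj₁ y≡d) = inj₂ (inj₂ (inj₂ y≡d))
    ... | inj₂ (inj₂ y≡b) = inj₂ (inj₁ y≡b)
    isolated-square-closed iso₀ i {y = y} e (inj₂ (inj₂ (inj₂ refl))) with D-neighbours i (inFactor⇒adj e)
    ... | inj₁ refl = ⊥-elim (proj₂ (isolated iso₀ (suc i)) (inFactor-sym e))
    ... | inj₂ (inj₁ y≡c) = inj₂ (inj₂ (inj₁ y≡c))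
    ... | inj₂ (inj₂ y≡a) = inj₁ y≡a

    A₁∉square₀ : ¬ InSquare 0 (A 1)
    A₁∉square₀ (inj₁ e)               = ≢-sym (near-≢ 1 1 3 (s≤s (s≤s z≤n)) (s≤s (s≤s (s≤s z≤n)))) e
    A₁∉square₀ (inj₂ (inj₁ e))        = ≢-sym (near-≢ 1 2 3 (s≤s (s≤s (s≤s z≤n))) (s≤s (s≤s (s≤s z≤n)))) e
    A₁∉square₀ (inj₂ (inj₂ (inj₁ e))) = across-≢ 1 3 2 (s≤s (s≤s (s≤s z≤n))) (s≤s (s≤s z≤n)) e
    A₁∉square₀ (inj₂ (inj₂ (inj₂ e))) = across-≢ 1 3 3 (s≤s (s≤s (s≤s z≤n))) (s≤s (s≤s (s≤s z≤n))) e

    A₁∉square-last : ¬ InSquare last (A 1)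
    A₁∉square-last (inj₁ e)               = across-≢ 1 3 0 (s≤s (s≤s (s≤s z≤n))) z≤n e
    A₁∉square-last (inj₂ (inj₁ e))        = across-≢ 1 3 1 (s≤s (s≤s (s≤s z≤n))) (s≤s z≤n) e
    A₁∉square-last (inj₂ (inj₂ (inj₁ e))) =
      ≢-sym (near-≢ 0 0 4 (s≤s z≤n) (s≤s (s≤s (s≤s (s≤s z≤n))))) (trans e C-last)
    A₁∉square-last (inj₂ (inj₂ (inj₂ e))) =
      ≢-sym (near-≢ 1 0 3 (s≤s z≤n) (s≤s (s≤s (s≤s z≤n)))) (trans e D-last)

    isolated-impossible : Isolated 0 → ⊥
    isolated-impossible iso₀ with covering (A 1)
    ... | inj₁ A₁∈C₁ = A₁∉square-last
      (closed⇒all-∈₁ {InSquare last} (isolated-square-closed iso₀ last) 1∈C₁ (inj₂ (inj₂ (inj₂ (sym D-last)))) A₁∈C₁)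
    ... | inj₂ A₁∈C₂ = A₁∉square₀ (closed⇒all-∈₂ {InSquare 0} (isolated-square-closed iso₀ 0) 2∈C₂ (inj₁ refl) A₁∈C₂)

    Traversed : ℕ → Set
    Traversed i = ExactlyOne (InFactor (A i) (A′ i)) (InFactor (C i) (C′ i))

    SquareInC₂ : ℕ → Set
    SquareInC₂ i = A i ∈ C₂ × B i ∈ C₂ × C i ∈ C₂ × D i ∈ C₂

    traversed : Traversed 0 → ∀ i → Traversed i × SquareInC₂ i
    traversed t₀ zero = t₀ , proj₂ (SquareAt.square-traversed 0 t₀) inFactor-closed₂ (inj₁ 2∈C₂)
    traversed t₀ (suc i) with tᵢ , (_ , bᵢ , _ , dᵢ) ← traversed t₀ i with proj₁ (SquareAt.square-traversed i tᵢ)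
    ... | inj₁ (bb′ , ¬dd′) = t , proj₂ (SquareAt.square-traversed (suc i) t) inFactor-closed₂ (inj₁ (inFactor-closed₂ bb′ bᵢ))
      where t = inj₁ (inFactor-sym bb′ , ¬dd′ ∘ inFactor-sym)
    ... | inj₂ (¬bb′ , dd′) = t , proj₂ (SquareAt.square-traversed (suc i) t) inFactor-closed₂ (inj₂ (inFactor-closed₂ dd′ dᵢ))
      where t = inj₂ (¬bb′ ∘ inFactor-sym , inFactor-sym dd′)

    traversed-impossible : Traversed 0 → ⊥
    traversed-impossible t₀ =
      disjoint (vertex 1) 1∈C₁ (subst (_∈ C₂) D-last (proj₂ (proj₂ (proj₂ (proj₂ (traversed t₀ last))))))

    impossible : ⊥
    impossible with at-C 0
    ... | without₁ ¬cc′ _ _ = isolated-impossible (¬A₀A′₀ , ¬cc′)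
    ... | without₂ cc′ _ _  = traversed-impossible (inj₂ (¬A₀A′₀ , cc′))
    ... | without₃ cc′ _ _  = traversed-impossible (inj₂ (¬A₀A′₀ , cc′))

  not-two-spanning-cyclable : ¬ TwoSpanningCyclable G
  not-two-spanning-cyclable cyclable
    with _ , _ , factor , 1∈C₁ , 2∈C₂ ← cyclable (vertex 1) (vertex 2) (near-≢ 1 0 1 (s≤s z≤n) (s≤s z≤n)) =
    impossible factor 1∈C₁ 2∈C₂

module FourVertices where

  open Column 4
  open Neighbours 4 1 (divides 2 refl) refl

  module _ {C₁ C₂ : List (Vertex 1 4)} (factor : IsTwoCycleTwoFactor (HTG 1 4 1) C₁ C₂)
           (1∈C₁ : vertex 1 ∈ C₁) (2∈C₂ : vertex 2 ∈ C₂) where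

    open TwoFactor HTG-sym factor

    ¬1→2 : ¬ InFactor (vertex 1) (vertex 2)
    ¬1→2 e = disjoint (vertex 2) (inFactor-closed₁ e 1∈C₁) 2∈C₂

    impossible : ⊥
    impossible with y , z , y≢z , 1y , 1z , _ ← inFactor-degreeTwo (vertex 1)
      with odd-neighbours {1} {0} refl refl (inFactor⇒adj 1y) | odd-neighbours {1} {0} refl refl (inFactor⇒adj 1z)
    ... | inj₁ refl        | _                = ¬1→2 1y
    ... | inj₂ (inj₂ refl) | _                = ¬1→2 1y
    ... | inj₂ (inj₁ refl) | inj₁ refl        = ¬1→2 1z
    ... | inj₂ (inj₁ refl) | inj₂ (inj₂ refl) = ¬1→2 1z
    ... | inj₂ (inj₁ refl) | inj₂ (inj₁ refl) = y≢z refl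

  not-two-spanning-cyclable : ¬ TwoSpanningCyclable (HTG 1 4 1)
  not-two-spanning-cyclable cyclable
    with _ , _ , factor , 1∈C₁ , 2∈C₂ ← cyclable (vertex 1) (vertex 2) (vertex-≢ 1 2 (s≤s z≤n) (s≤s (s≤s z≤n)) refl) =
    impossible factor 1∈C₁ 2∈C₂

proposition2p2 : (n : ℕ) → 4 ≤ n → 4 ∣ n → n ≢ 8 →
    ¬ TwoSpanningCyclable (HTG 1 n ((n ∸ 2) / 2))
proposition2p2 _ ()  (divides 0 refl) _
proposition2p2 _ _   (divides 1 refl) _   = FourVertices.not-two-spanning-cyclable
proposition2p2 _ _   (divides 2 refl) n≢8 = ⊥-elim (n≢8 refl)
proposition2p2 _ _   (divides (suc (suc (suc k))) refl) _ =
  subst (λ ℓ → ¬ TwoSpanningCyclable (HTG 1 (Ladder.n k) ℓ)) (sym jump-length) (Ladder.not-two-spanning-cyclable k)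
  where
    jump-length : (10 + k * 4) / 2 ≡ 5 + k * 2
    jump-length = trans (cong (λ r → (10 + r) / 2) (sym (*-assoc k 2 2))) (m*n/n≡m (5 + k * 2) 2)
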